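{- For every tree $T$, the graph-stable set pair $(T,\{\{u\} : u\in V(T)\})$ is constructible.
   Context: A graph-stable set pair $(G,\mathcal S)$ is a graph $G$ with a set $\mathcal S$ of stable sets of $G$; $(G,\mathcal S)$ is an induced subgraph-stable set pair of $(H,\mathcal S')$ if $G$ is an induced subgraph of $H$ and $\mathcal S\subseteq\{S'\cap V(G): S'\in\mathcal S'\}$. The procedure $\mathrm{NEXT}(G,\mathcal S)=(G',\mathcal S')$: add, for each $S\in\mathcal S$, a disjoint copy $(H_S,\mathcal S(H_S))$ of $(G,\mathcal S)$; for each $S\in\mathcal S$ and $T\in\mathcal S(H_S)$ add a new vertex $v_{S,T}$ whose neighborhood is exactly $T$; and set $\mathcal S'=\{S\cup T: S\in\mathcal S, T\in\mathcal S(H_S)\}\cup\{S\cup\{v_{S,T}\}: S\in\mathcal S, T\in\mathcal S(H_S)\}$. A graph-stable set pair is constructible if it is an induced subgraph-stable set pair of $\mathrm{NEXT}^i(G_0,\mathcal S_0)$ for some $i\ge0$, where $G_0=K_1$ and $\mathcal S_0=\{V(G_0)\}$. -}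

module Defs where

open import Data.Nat using (ℕ; zero; suc; _≤_)
open import Data.Fin using (Fin)
open import Data.Bool using (Bool; true; false; T)
open import Data.Unit using (⊤)
open import Data.Empty using (⊥)
open import Data.Sum using (_⊎_; inj₁; inj₂)
open import Data.Product using (Σ; ∃; _×_; _,_)
open import Data.List using (List; []; _∷_; length; _∷ʳ_)
open import Data.List.Relation.Unary.Linked using (Linked)
open import Data.List.Relation.Unary.Unique.Propositional using (Unique)
open import Function.Bundles using (_⇔_)
open import Relation.Binary.PropositionalEquality using (_≡_)
open import Relation.Nullary using (¬_)

-- The set 𝒮 of stable sets is given as a family S : I → (V → Set)
-- indexed by a type I (S i is the i-th member of 𝒮, as a predicate on V).

record GSP : Set₁ where
  field
    V : Set
    E : V → V → Set
    I : Set
    S : I → V → Set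

open GSP public

record _≼_ (P Q : GSP) : Set where
  field
    f       : V P → V Q
    f-inj   : ∀ x y → f x ≡ f y → x ≡ y
    induced : ∀ x y → E P x y ⇔ E Q (f x) (f y)
    traces  : ∀ i → Σ (I Q) λ j → ∀ x → S P i x ⇔ S Q j (f x)

-- Vertices: V ⊎ (I × (V ⊎ I)):
--   inj₁ x                  : vertex x of G
--   inj₂ (i , inj₁ y)       : vertex y of the copy H_{S i}
--   inj₂ (i , inj₂ j)       : the new vertex v_{S i , T j}
--     (T j is the copy of S j inside H_{S i}); its neighbourhood is exactly T j.
-- Stable sets, indexed by I × I × Bool:
--   (i , j , false) ↦ S i ∪ T j        (T j ⊆ H_{S i})
--   (i , j , true)  ↦ S i ∪ {v_{S i , T j}}

module _ (P : GSP) where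
  private
    V' : Set
    V' = V P ⊎ (I P × (V P ⊎ I P))

    E' : V' → V' → Set
    E' (inj₁ x) (inj₁ y) = E P x y
    E' (inj₂ (i , inj₁ x)) (inj₂ (i' , inj₁ y)) = (i ≡ i') × E P x y
    E' (inj₂ (i , inj₁ x)) (inj₂ (i' , inj₂ j)) = (i ≡ i') × S P j x
    E' (inj₂ (i , inj₂ j)) (inj₂ (i' , inj₁ y)) = (i ≡ i') × S P j y
    E' _ _ = ⊥

    I' : Set
    I' = I P × I P × Bool

    S' : I' → V' → Set
    S' (i , j , _)     (inj₁ x)                = S P i x
    S' (i , j , false) (inj₂ (i' , inj₁ y))    = (i' ≡ i) × S P j y
    S' (i , j , false) (inj₂ (i' , inj₂ j'))   = ⊥
    S' (i , j , true)  (inj₂ (i' , inj₁ y))    = ⊥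
    S' (i , j , true)  (inj₂ (i' , inj₂ j'))   = (i' ≡ i) × (j' ≡ j)

  NEXT : GSP
  NEXT = record { V = V' ; E = E' ; I = I' ; S = S' }

K1-pair : GSP
K1-pair = record { V = ⊤ ; E = λ _ _ → ⊥ ; I = ⊤ ; S = λ _ _ → ⊤ }

NEXT^ : ℕ → GSP
NEXT^ zero    = K1-pair
NEXT^ (suc k) = NEXT (NEXT^ k)

Constructible : GSP → Set
Constructible P = ∃ λ (k : ℕ) → P ≼ NEXT^ k

record SimpleGraph (n : ℕ) : Set where
  field
    adj    : Fin n → Fin n → Bool
    sym    : ∀ u v → adj u v ≡ adj v u
    irrefl : ∀ u → adj u u ≡ false

open SimpleGraph public

Adj : ∀ {n} → SimpleGraph n → Fin n → Fin n → Set
Adj G u v = T (adj G u v)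

data Walk {n} (G : SimpleGraph n) : Fin n → Fin n → Set where
  [] : ∀ {u} → Walk G u u
  _∷_ : ∀ {u v w} → Adj G u v → Walk G v w → Walk G u w

Connected : ∀ {n} → SimpleGraph n → Set
Connected G = ∀ u v → Walk G u v

record Cycle {n} (G : SimpleGraph n) : Set where
  field
    u      : Fin n
    ws     : List (Fin n)
    long   : 2 ≤ length ws
    unique : Unique (u ∷ ws)
    linked : Linked (Adj G) ((u ∷ ws) ∷ʳ u)

Acyclic : ∀ {n} → SimpleGraph n → Set
Acyclic G = ¬ Cycle G

IsTree : ∀ {n} → SimpleGraph n → Set
IsTree {n} G = (1 ≤ n) × Connected G × Acyclic G

singletonPair : ∀ {n} → SimpleGraph n → GSP
singletonPair {n} G = record
  { V = Fin n ; E = Adj G ; I = Fin n ; S = λ u v → u ≡ v }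

module Submission where

-- The tree is grown one leaf at a time.  For a set X of vertices of a fixed
-- graph G (kept as a list) we maintain an embedding of the singleton pair
-- (G[X], {{u} : u ∈ X}) into some pair Q.  The core step (`extend`) shows that
-- if a new vertex v ∉ X has exactly one neighbour p in X, then the embedding
-- lifts to NEXT Q: the old vertices are sent into the copy H_{S} of Q indexed
-- by the trace S of {p}, and v is sent to the new vertex v_{S,T} where T is the
-- copy of that trace inside H_S, whose neighbourhood is exactly the image of p.
-- In a tree, a vertex v ∉ X adjacent to some p ∈ X has no other neighbour in X
-- as long as G[X] is connected by simple paths (otherwise there is a cycle);
-- this is `unique-neighbour`, and the connectivity invariant itself survives
-- adding such a leaf (`connected-extend`).  Starting from a single vertex
-- (embedded in K₁ = NEXT⁰) and following walks from it, every vertex of the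
-- connected graph is absorbed; the final embedding of all of V(G) into
-- NEXTᵏ(K₁) is the required induced subgraph-stable set pair.

open import Defs hiding (sym)
open import Data.Nat using (ℕ; zero; suc; s≤s; z≤n)
open import Data.Fin using (Fin) renaming (_≟_ to _≟F_; zero to fzero)
open import Data.Bool using (T; true; false)
open import Data.Unit using (tt)
open import Data.Empty using (⊥-elim)
open import Data.Sum using (_⊎_; inj₁; inj₂)
open import Data.Product using (Σ; _×_; _,_; proj₁; proj₂)
open import Data.List using (List; []; _∷_; _∷ʳ_; allFin)
open import Data.List.Relation.Unary.All using (All; []; _∷_) renaming (map to All-map; lookup to All-lookup)
open import Data.List.Relation.Unary.All.Properties using (∷ʳ⁺)
open import Data.List.Relation.Unary.Any using (here; there)
open import Data.List.Relation.Unary.Linked using (Linked; [-]; _∷_)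
open import Data.List.Relation.Unary.Unique.Propositional using (Unique)
open import Data.List.Relation.Unary.Unique.Propositional.Properties using (++⁺)
open import Data.List.Relation.Unary.AllPairs using ([]; _∷_)
open import Data.List.Membership.Propositional using (_∈_; _∉_)
open import Data.List.Membership.Propositional.Properties using (∈-allFin)
import Data.List.Membership.DecPropositional as DecMembership
open import Function.Bundles using (_⇔_; mk⇔; Equivalence)
open import Relation.Binary.PropositionalEquality using (_≡_; refl; sym; trans; subst)
open import Relation.Nullary using (¬_; yes; no)

open Equivalence using (to; from)

∈-singleton : ∀ {A : Set} {x r : A} → x ∈ r ∷ [] → x ≡ r
∈-singleton (here eq) = eq
∈-singleton (there ())

∉⇒All≢ : ∀ {A : Set} {X zs : List A} {v : A} → v ∉ X → All (_∈ X) zs → All (λ z → ¬ v ≡ z) zs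
∉⇒All≢ v∉X = All-map (λ { z∈X refl → v∉X z∈X })

copy-injective : ∀ {A B C D : Set} {i j : A} {a b : B} →
  _≡_ {A = C ⊎ (A × (B ⊎ D))} (inj₂ (i , inj₁ a)) (inj₂ (j , inj₁ b)) → a ≡ b
copy-injective refl = refl

module _ {n : ℕ} (G : SimpleGraph n) where
  open DecMembership (_≟F_ {n}) using (_∈?_)

  adj-sym : ∀ {x y} → Adj G x y → Adj G y x
  adj-sym {x} {y} = subst T (SimpleGraph.sym G x y)

  adj-irrefl : ∀ x → ¬ Adj G x x
  adj-irrefl x = subst T (irrefl G x)

  -- `Path x z ws`: x, ws is a walk ending in z (ws lists the vertices after x).
  data Path : Fin n → Fin n → List (Fin n) → Set where
    stop : ∀ {x} → Path x x []
    step : ∀ {x y z ws} → Adj G x y → Path y z ws → Path x z (y ∷ ws)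

  path-snoc : ∀ {a b c ws} → Path a b ws → Adj G b c → Path a c (ws ∷ʳ c)
  path-snoc stop       bc = step bc stop
  path-snoc (step e r) bc = step e (path-snoc r bc)

  -- A path a … b followed by an edge b c is a linked sequence; closing it
  -- back to its start is how a cycle is exhibited.
  path-linked : ∀ {a b c ws} → Path a b ws → Adj G b c → Linked (Adj G) (a ∷ (ws ∷ʳ c))
  path-linked stop       bc = bc ∷ [-]
  path-linked (step e r) bc = e ∷ path-linked r bc

  SimplePathIn : List (Fin n) → Fin n → Fin n → Set
  SimplePathIn X x y = Σ (List (Fin n)) λ ws → Path x y ws × Unique (x ∷ ws) × All (_∈ X) (x ∷ ws)

  PathConnected : List (Fin n) → Set
  PathConnected X = ∀ {x y} → x ∈ X → y ∈ X → SimplePathIn X x y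

  -- In an acyclic graph, a vertex v outside a path-connected X which is
  -- adjacent to p ∈ X has no other neighbour in X: a second neighbour y would
  -- close the cycle v, p, …, y, v.
  unique-neighbour : Acyclic G → ∀ {X p v y} → PathConnected X →
    p ∈ X → v ∉ X → Adj G p v → y ∈ X → Adj G v y → y ≡ p
  unique-neighbour acyclic {_} {p} {v} {y} conn p∈X v∉X pv y∈X vy with y ≟F p
  ... | yes y≡p = y≡p
  ... | no y≢p with conn p∈X y∈X
  ...   | [] , stop , _ = ⊥-elim (y≢p refl)
  ...   | (y' ∷ ws) , pth , unique , inX = ⊥-elim (acyclic cycle)
    where
    cycle : Cycle G
    cycle = record
      { u = v ; ws = p ∷ y' ∷ ws ; long = s≤s (s≤s z≤n)
      ; unique = ∉⇒All≢ v∉X inX ∷ unique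
      ; linked = adj-sym pv ∷ path-linked pth (adj-sym vy) }

  -- Attaching a leaf v to p ∈ X keeps X path-connected: paths to or from v
  -- are paths to or from p extended by the edge p v.
  connected-extend : ∀ {X p v} → PathConnected X → p ∈ X → v ∉ X → Adj G p v →
    PathConnected (v ∷ X)
  connected-extend conn p∈X v∉X pv (here refl) (here refl) =
    [] , stop , [] ∷ [] , here refl ∷ []
  connected-extend conn p∈X v∉X pv (here refl) (there y∈X) with conn p∈X y∈X
  ... | ws , pth , unique , inX =
    (_ ∷ ws) , step (adj-sym pv) pth , ∉⇒All≢ v∉X inX ∷ unique , here refl ∷ All-map there inX
  connected-extend {v = v} conn p∈X v∉X pv (there x∈X) (here refl) with conn x∈X p∈X
  ... | ws , pth , unique , inX =
    (ws ∷ʳ v) , path-snoc pth pv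
    , ++⁺ unique ([] ∷ []) disjoint
    , ∷ʳ⁺ (All-map there inX) (here refl)
    where
    disjoint : ∀ {z} → ¬ (z ∈ _ × z ∈ v ∷ [])
    disjoint (z∈ws , here refl) = v∉X (All-lookup inX z∈ws)
  connected-extend conn p∈X v∉X pv (there x∈X) (there y∈X) with conn x∈X y∈X
  ... | ws , pth , unique , inX = ws , pth , unique , All-map there inX

  record Embedding (X : List (Fin n)) (Q : GSP) : Set where
    field
      f       : Fin n → V Q
      f-inj   : ∀ {x y} → x ∈ X → y ∈ X → f x ≡ f y → x ≡ y
      induced : ∀ {x y} → x ∈ X → y ∈ X → Adj G x y ⇔ E Q (f x) (f y)
      traces  : ∀ {u} → u ∈ X → Σ (I Q) λ j → ∀ {x} → x ∈ X → (u ≡ x) ⇔ S Q j (f x)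

  embedding-K1 : ∀ r → Embedding (r ∷ []) K1-pair
  embedding-K1 r = record
    { f       = λ _ → tt
    ; f-inj   = λ x∈ y∈ _ → trans (∈-singleton x∈) (sym (∈-singleton y∈))
    ; induced = λ x∈ y∈ → mk⇔ (λ e → adj-irrefl r (loop-at-r (∈-singleton x∈) (∈-singleton y∈) e)) ⊥-elim
    ; traces  = λ u∈ → tt , λ x∈ → mk⇔ _ (λ _ → trans (∈-singleton u∈) (sym (∈-singleton x∈))) }
    where
    loop-at-r : ∀ {x y} → x ≡ r → y ≡ r → Adj G x y → Adj G r r
    loop-at-r refl refl e = e

  -- With S the stable set
  -- of Q tracing {p}, X goes into the copy H_S and v to the vertex v_{S,S}
  -- whose neighbourhood is the copy of S in H_S, i.e. the image of p there.
  module Extend {X p v Q} (emb : Embedding X Q) (p∈X : p ∈ X) (v∉X : v ∉ X)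
                (pv : Adj G p v) (only-p : ∀ {y} → y ∈ X → Adj G v y → y ≡ p) where
    open Embedding emb

    s : I Q
    s = proj₁ (traces p∈X)

    s-traces-p : ∀ {x} → x ∈ X → (p ≡ x) ⇔ S Q s (f x)
    s-traces-p = proj₂ (traces p∈X)

    new : V (NEXT Q)
    new = inj₂ (s , inj₂ s)

    old : V Q → V (NEXT Q)
    old a = inj₂ (s , inj₁ a)

    f' : Fin n → V (NEXT Q)
    f' x with x ≟F v
    ... | yes _ = new
    ... | no  _ = old (f x)

    f'-new : f' v ≡ new
    f'-new with v ≟F v
    ... | yes _   = refl
    ... | no  v≢v = ⊥-elim (v≢v refl)

    f'-old : ∀ {x} → x ∈ X → f' x ≡ old (f x)
    f'-old {x} x∈X with x ≟F v
    ... | yes refl = ⊥-elim (v∉X x∈X)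
    ... | no  _    = refl

    adj-v : ∀ {y} → y ∈ X → Adj G v y ⇔ S Q s (f y)
    adj-v y∈X = mk⇔ (λ vy → to (s-traces-p y∈X) (sym (only-p y∈X vy)))
                    (λ sy → subst (Adj G v) (from (s-traces-p y∈X) sy) (adj-sym pv))

    f'-inj : ∀ {x y} → x ∈ v ∷ X → y ∈ v ∷ X → f' x ≡ f' y → x ≡ y
    f'-inj (here refl) (here refl) _ = refl
    f'-inj (here refl) (there y∈X) eq with trans (sym f'-new) (trans eq (f'-old y∈X))
    ... | ()
    f'-inj (there x∈X) (here refl) eq with trans (sym (f'-old x∈X)) (trans eq f'-new)
    ... | ()
    f'-inj (there x∈X) (there y∈X) eq with trans (sym (f'-old x∈X)) (trans eq (f'-old y∈X))
    ... | old-fx≡old-fy = f-inj x∈X y∈X (copy-injective old-fx≡old-fy)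

    f'-induced : ∀ {x y} → x ∈ v ∷ X → y ∈ v ∷ X → Adj G x y ⇔ E (NEXT Q) (f' x) (f' y)
    f'-induced (here refl) (here refl) rewrite f'-new =
      mk⇔ (adj-irrefl v) ⊥-elim
    f'-induced (here refl) (there y∈X) rewrite f'-new | f'-old y∈X =
      mk⇔ (λ vy → refl , to (adj-v y∈X) vy) (λ (_ , sy) → from (adj-v y∈X) sy)
    f'-induced (there x∈X) (here refl) rewrite f'-new | f'-old x∈X =
      mk⇔ (λ xv → refl , to (adj-v x∈X) (adj-sym xv)) (λ (_ , sx) → adj-sym (from (adj-v x∈X) sx))
    f'-induced (there x∈X) (there y∈X) rewrite f'-old x∈X | f'-old y∈X =
      mk⇔ (λ xy → refl , to (induced x∈X y∈X) xy) (λ (_ , e) → from (induced x∈X y∈X) e)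

    -- {v} is traced by S ∪ {v_{S,S}}, and {u} for u ∈ X by S ∪ T_u with
    -- T_u the copy in H_S of the trace of {u}.
    f'-traces : ∀ {u} → u ∈ v ∷ X → Σ (I (NEXT Q)) λ i → ∀ {x} → x ∈ v ∷ X → (u ≡ x) ⇔ S (NEXT Q) i (f' x)
    f'-traces (here refl) = (s , s , true) , trace-v
      where
      trace-v : ∀ {x} → x ∈ v ∷ X → (v ≡ x) ⇔ S (NEXT Q) (s , s , true) (f' x)
      trace-v (here refl) rewrite f'-new = mk⇔ (λ _ → refl , refl) (λ _ → refl)
      trace-v (there x∈X) rewrite f'-old x∈X = mk⇔ (λ { refl → v∉X x∈X }) ⊥-elim
    f'-traces {u} (there u∈X) = (s , proj₁ (traces u∈X) , false) , trace-u
      where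
      t : I Q
      t = proj₁ (traces u∈X)

      trace-u : ∀ {x} → x ∈ v ∷ X → (u ≡ x) ⇔ S (NEXT Q) (s , t , false) (f' x)
      trace-u (here refl) rewrite f'-new = mk⇔ (λ { refl → v∉X u∈X }) ⊥-elim
      trace-u (there x∈X) rewrite f'-old x∈X =
        mk⇔ (λ u≡x → refl , to (proj₂ (traces u∈X) x∈X) u≡x)
            (λ (_ , sx) → from (proj₂ (traces u∈X) x∈X) sx)

    embedding : Embedding (v ∷ X) (NEXT Q)
    embedding = record { f = f' ; f-inj = f'-inj ; induced = f'-induced ; traces = f'-traces }

  extend : ∀ {X p v Q} → Embedding X Q → p ∈ X → v ∉ X → Adj G p v →
    (∀ {y} → y ∈ X → Adj G v y → y ≡ p) → Embedding (v ∷ X) (NEXT Q)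
  extend emb p∈X v∉X pv only-p = Extend.embedding emb p∈X v∉X pv only-p

  embedding⇒≼ : ∀ {X Q} → Embedding X Q → (∀ x → x ∈ X) → singletonPair G ≼ Q
  embedding⇒≼ emb all∈X = record
    { f       = f
    ; f-inj   = λ x y → f-inj (all∈X x) (all∈X y)
    ; induced = λ x y → induced (all∈X x) (all∈X y)
    ; traces  = λ u → proj₁ (traces (all∈X u)) , λ x → proj₂ (traces (all∈X u)) (all∈X x) }
    where open Embedding emb

  record Grown (X : List (Fin n)) : Set₁ where
    field
      k         : ℕ
      embedding : Embedding X (NEXT^ k)
      connected : PathConnected X

  module _ (acyclic : Acyclic G) where

    grow : ∀ {X p v} → Grown X → p ∈ X → v ∉ X → Adj G p v → Grown (v ∷ X)
    grow g p∈X v∉X pv = record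
      { k         = suc k
      ; embedding = extend embedding p∈X v∉X pv (unique-neighbour acyclic connected p∈X v∉X pv)
      ; connected = connected-extend connected p∈X v∉X pv }
      where open Grown g

    -- Following a walk from a vertex of X, its end is absorbed into a larger
    -- grown set, adding each vertex of the walk not yet present as a leaf.
    absorb : ∀ {X a w} → Grown X → a ∈ X → Walk G a w →
      Σ (List (Fin n)) λ X' → Grown X' × (∀ {z} → z ∈ X → z ∈ X') × w ∈ X'
    absorb g a∈X [] = _ , g , (λ z∈X → z∈X) , a∈X
    absorb {X} g a∈X (_∷_ {v = b} ab rest) with b ∈? X
    ... | yes b∈X = absorb g b∈X rest
    ... | no  b∉X with absorb (grow g a∈X b∉X ab) (here refl) rest
    ...   | X' , g' , ⊆X' , w∈X' = X' , g' , (λ z∈X → ⊆X' (there z∈X)) , w∈X'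

    cover : Connected G → (r : Fin n) (ws : List (Fin n)) →
      Σ (List (Fin n)) λ X → Grown X × r ∈ X × All (_∈ X) ws
    cover conn r [] = (r ∷ []) , initial , here refl , []
      where
      initial : Grown (r ∷ [])
      initial = record
        { k         = 0
        ; embedding = embedding-K1 r
        ; connected = λ { (here refl) (here refl) → [] , stop , [] ∷ [] , here refl ∷ []
                        ; _ (there ()) ; (there ()) _ } }
    cover conn r (w ∷ ws) with cover conn r ws
    ... | X , g , r∈X , ws∈X with absorb g r∈X (conn r w)
    ...   | X' , g' , ⊆X' , w∈X' = X' , g' , ⊆X' r∈X , w∈X' ∷ All-map ⊆X' ws∈X

lemma8 : (n : ℕ) (G : SimpleGraph n) → IsTree G → Constructible (singletonPair G)
lemma8 zero    G (() , _)
lemma8 (suc m) G (_ , conn , acyclic) with cover G acyclic conn fzero (allFin (suc m))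
... | X , g , _ , all∈X = k , embedding⇒≼ G embedding (λ x → All-lookup all∈X (∈-allFin x))
  where open Grown g
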